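{- Let $\mathcal{C}$ be a category with an $(\mathcal{E},\mathcal{M})$-factorization system, $I$ an object, and $F\colon\mathcal{C}\to\mathcal{C}$ a functor that preserves $\mathcal{M}$ and admits precise factorizations w.r.t. $\mathcal{M}$. Let $(C,c,i_C)$ be a pointed $F$-coalgebra and construct $m_k\colon C_k\to C$ in $\mathcal{M}$ and $F$-precise $c_k\colon C_k\to FC_{k+1}$ ($k\in\mathbb{N}$) by: $i_C=m_0\cdot i_C'$ is an $(\mathcal{E},\mathcal{M})$-factorization ($i_C'\colon I\to C_0$ in $\mathcal{E}$, $m_0\in\mathcal{M}$), and for each $k$, $c\cdot m_k=Fm_{k+1}\cdot c_k$ is a precise factorization (with $m_{k+1}\in\mathcal{M}$, $c_k$ $F$-precise). Assume $\coprod_{k\in\mathbb{N}}C_k$ exists and equip it with the pointed coalgebra structure $\gamma=[F\mathsf{in}_{k+1}]_k\cdot\coprod_kc_k$ and point $\mathsf{in}_0\cdot i_C'$, so that $[m_k]_k$ is a pointed coalgebra morphism to $(C,c,i_C)$. Let $[m_k]_{k}=m'\cdot e$ be an $(\mathcal{E},\mathcal{M})$-factorization in $\mathcal{C}$ with $e\colon\coprod_kC_k\to R$ in $\mathcal{E}$ and $m'\colon R\to C$ in $\mathcal{M}$, let $r\colon R\to FR$ be the unique diagonal fill-in with $r\cdot e=Fe\cdot\gamma$ and $Fm'\cdot r=c\cdot m'$, and let $i_R=e\cdot\mathsf{in}_0\cdot i_C'$. Then the pointed coalgebra $(R,r,i_R)$ is $\mathcal{M}$-reachable (and $m'\colon(R,r,i_R)\to(C,c,i_C)$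 is an $\mathcal{M}$-subcoalgebra).
   Context: An $(\mathcal{E},\mathcal{M})$-factorization system: classes $\mathcal{E},\mathcal{M}$ closed under composition, containing all isomorphisms, every morphism factors as $m\cdot e$ ($e\in\mathcal{E}$, $m\in\mathcal{M}$), with unique diagonal fill-ins for commutative squares $g\cdot e=m\cdot f$; $\mathcal{M}$ need not consist of monomorphisms. $F$ preserves $\mathcal{M}$ if $Fm\in\mathcal{M}$ for $m\in\mathcal{M}$. A morphism $p\colon P\to FR$ is $F$-precise (w.r.t. $\mathcal{M}$) if for all $f\colon P\to FC'$ and $m\colon R\to D$, $h\colon C'\to D$ in $\mathcal{M}$ with $Fm\cdot p=Fh\cdot f$ there is $d\colon R\to C'$ with $Fd\cdot p=f$ and $h\cdot d=m$. $F$ admits precise factorizations if every $f\colon S\to FY$ equals $Fh\cdot p$ for some $h\in\mathcal{M}$ and $F$-precise $p$. A pointed $F$-coalgebra is $(C,c,i_C)$ with $c\colon C\to FC$, $i_C\colon I\to C$; pointed coalgebra morphisms $h$ satisfy $d\cdot h=Fh\cdot c$ and preserve points. A split epimorphism of pointed coalgebras is a pointed coalgebra morphism $h$ with a pointed coalgebra morphism $s$, $h\cdot s=\mathrm{id}$. A pointed coalgebra is $\mathcal{M}$-reachable if every pointed coalgebra morphism into it whose underlying morphism is in $\mathcal{M}$ is a split epimorphism of pointed coalgebras. -}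

module Defs where

open import Level using (Level; _⊔_) renaming (suc to lsuc)
open import Data.Nat using (ℕ; zero; suc)
open import Data.Product using (Σ; _×_; _,_; ∃-syntax)
open import Relation.Binary.PropositionalEquality using (_≡_)

record Category (o ℓ : Level) : Set (lsuc (o ⊔ ℓ)) where
  infixr 9 _∘_
  field
    Obj  : Set o
    Hom  : Obj → Obj → Set ℓ
    id   : ∀ {A} → Hom A A
    _∘_  : ∀ {A B C} → Hom B C → Hom A B → Hom A C
    assoc     : ∀ {A B C D} {f : Hom A B} {g : Hom B C} {h : Hom C D} →
                (h ∘ g) ∘ f ≡ h ∘ (g ∘ f)
    identityˡ : ∀ {A B} {f : Hom A B} → id ∘ f ≡ f
    identityʳ : ∀ {A B} {f : Hom A B} → f ∘ id ≡ f

record Endofunctor {o ℓ} (𝒞 : Category o ℓ) : Set (o ⊔ ℓ) where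
  open Category 𝒞
  field
    F₀ : Obj → Obj
    F₁ : ∀ {A B} → Hom A B → Hom (F₀ A) (F₀ B)
    identity     : ∀ {A} → F₁ (id {A}) ≡ id
    homomorphism : ∀ {A B C} {f : Hom A B} {g : Hom B C} →
                   F₁ (g ∘ f) ≡ F₁ g ∘ F₁ f

module _ {o ℓ} (𝒞 : Category o ℓ) where
  open Category 𝒞

  MorClass : (p : Level) → Set (o ⊔ ℓ ⊔ lsuc p)
  MorClass p = ∀ {A B} → Hom A B → Set p

  IsIso : ∀ {A B} → Hom A B → Set ℓ
  IsIso {A} {B} f = Σ (Hom B A) λ g → (g ∘ f ≡ id) × (f ∘ g ≡ id)

  -- (E,M)-factorization system (M need not consist of monos)
  record FactorizationSystem (p : Level) : Set (o ⊔ ℓ ⊔ lsuc p) where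
    field
      E : MorClass p
      M : MorClass p
      E-∘   : ∀ {A B C} {f : Hom A B} {g : Hom B C} → E f → E g → E (g ∘ f)
      M-∘   : ∀ {A B C} {f : Hom A B} {g : Hom B C} → M f → M g → M (g ∘ f)
      E-iso : ∀ {A B} {f : Hom A B} → IsIso f → E f
      M-iso : ∀ {A B} {f : Hom A B} → IsIso f → M f
      factor : ∀ {A B} (f : Hom A B) →
               Σ Obj λ X → Σ (Hom A X) λ e → Σ (Hom X B) λ m →
                 E e × M m × (f ≡ m ∘ e)
      diagonal : ∀ {A B C D} {e : Hom A B} {f : Hom A C} {m : Hom C D}
                   {g : Hom B D} → E e → M m → g ∘ e ≡ m ∘ f →
                 Σ (Hom B C) λ d → (d ∘ e ≡ f) × (m ∘ d ≡ g) ×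
                   (∀ (d' : Hom B C) → d' ∘ e ≡ f → m ∘ d' ≡ g → d' ≡ d)

  module _ {p} (M : MorClass p) (F : Endofunctor 𝒞) where
    open Endofunctor F

    PreservesM : Set (o ⊔ ℓ ⊔ p)
    PreservesM = ∀ {A B} {m : Hom A B} → M m → M (F₁ m)

    IsPrecise : ∀ {P R} → Hom P (F₀ R) → Set (o ⊔ ℓ ⊔ p)
    IsPrecise {P} {R} q =
      ∀ {C' D} (f : Hom P (F₀ C')) (m : Hom R D) (h : Hom C' D) →
        M m → M h → F₁ m ∘ q ≡ F₁ h ∘ f →
        Σ (Hom R C') λ d → (F₁ d ∘ q ≡ f) × (h ∘ d ≡ m)

    AdmitsPreciseFactorizations : Set (o ⊔ ℓ ⊔ p)
    AdmitsPreciseFactorizations =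
      ∀ {S Y} (f : Hom S (F₀ Y)) →
        Σ Obj λ X → Σ (Hom X Y) λ h → Σ (Hom S (F₀ X)) λ q →
          M h × IsPrecise q × (f ≡ F₁ h ∘ q)

  module _ (F : Endofunctor 𝒞) (I : Obj) where
    open Endofunctor F

    record PointedCoalgebra : Set (o ⊔ ℓ) where
      constructor pcoalg
      field
        carrier : Obj
        str     : Hom carrier (F₀ carrier)
        point   : Hom I carrier
    open PointedCoalgebra

    IsPointedCoalgebraMorphism : (A B : PointedCoalgebra) →
      Hom (carrier A) (carrier B) → Set ℓ
    IsPointedCoalgebraMorphism A B h =
      (str B ∘ h ≡ F₁ h ∘ str A) × (h ∘ point A ≡ point B)

    IsSplitEpiPC : (A B : PointedCoalgebra) → Hom (carrier A) (carrier B) → Set ℓ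
    IsSplitEpiPC A B h =
      IsPointedCoalgebraMorphism A B h ×
      Σ (Hom (carrier B) (carrier A)) λ s →
        IsPointedCoalgebraMorphism B A s × (h ∘ s ≡ id)

    IsMReachable : ∀ {p} → MorClass p → PointedCoalgebra → Set (o ⊔ ℓ ⊔ p)
    IsMReachable M B =
      ∀ (A : PointedCoalgebra) (h : Hom (carrier A) (carrier B)) →
        IsPointedCoalgebraMorphism A B h → M h → IsSplitEpiPC A B h

  record Coproductℕ (X : ℕ → Obj) : Set (o ⊔ ℓ) where
    field
      ∐    : Obj
      inj  : ∀ k → Hom (X k) ∐
      [_]  : ∀ {Y} → (∀ k → Hom (X k) Y) → Hom ∐ Y
      commute : ∀ {Y} (f : ∀ k → Hom (X k) Y) k → [ f ] ∘ inj k ≡ f k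
      unique  : ∀ {Y} (f : ∀ k → Hom (X k) Y) (g : Hom ∐ Y) →
                (∀ k → g ∘ inj k ≡ f k) → g ≡ [ f ]

-- Since m′ ∘ e ∘ inj_{k+1} = m_{k+1} ∈ M, left cancellation puts e ∘ inj_{k+1} in M. Given a
-- pointed coalgebra morphism h : A → R in M, lift the chain C₀ → F C₁ → … through h one
-- step at a time: C₀ lifts because i_C′ ∈ E, and C_{k+1} lifts along F h because c_k is
-- F-precise. The lifts assemble into a coalgebra morphism s′ : ∐ C_k → A with h ∘ s′ = e,
-- and the diagonal fill-in of this triangle against h is a section of h, which is again a
-- coalgebra morphism because F h ∈ M.
module Submission where

open import Defs
open import Data.Nat using (ℕ; zero; suc)
open import Data.Product using (Σ-syntax; _×_; _,_; proj₁; proj₂)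
open import Relation.Binary.PropositionalEquality
  using (_≡_; refl; sym; trans; cong; subst; module ≡-Reasoning)

module FactorizationProperties {o ℓ p} {𝒞 : Category o ℓ} (FS : FactorizationSystem 𝒞 p) where
  open Category 𝒞
  open FactorizationSystem FS
  open ≡-Reasoning

  diagonal-unique : ∀ {A B C D} {e : Hom A B} {f : Hom A C} {m : Hom C D} {g : Hom B D} →
                    E e → M m → g ∘ e ≡ m ∘ f → {d₁ d₂ : Hom B C} →
                    d₁ ∘ e ≡ f → m ∘ d₁ ≡ g → d₂ ∘ e ≡ f → m ∘ d₂ ≡ g → d₁ ≡ d₂
  diagonal-unique Ee Mm square d₁e d₁m d₂e d₂m =
    let unique = proj₂ (proj₂ (proj₂ (diagonal Ee Mm square)))
    in trans (unique _ d₁e d₁m) (sym (unique _ d₂e d₂m))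

  M-cancelˡ : ∀ {A B C} {f : Hom A B} {g : Hom B C} → M g → M (g ∘ f) → M f
  M-cancelˡ {f = f} {g} Mg Mgf with factor f
  ... | _ , e , m , Ee , Mm , f≡me
      with diagonal Ee Mgf (trans (trans assoc (cong (g ∘_) (sym f≡me))) (sym identityʳ))
  ...   | d , d∘e≡id , gf∘d≡gm , _ =
    subst (λ x → M x) (sym f≡me) (M-∘ (M-iso (d , d∘e≡id , e∘d≡id)) Mm)
    where
    f∘d≡m : f ∘ d ≡ m
    f∘d≡m = diagonal-unique Ee Mg (trans assoc (cong (g ∘_) (sym f≡me)))
      (begin (f ∘ d) ∘ e ≡⟨ assoc ⟩ f ∘ (d ∘ e) ≡⟨ cong (f ∘_) d∘e≡id ⟩ f ∘ id ≡⟨ identityʳ ⟩ f ∎)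
      (trans (sym assoc) gf∘d≡gm)
      (sym f≡me) refl

    e∘d≡id : e ∘ d ≡ id
    e∘d≡id = diagonal-unique Ee Mm refl
      (begin (e ∘ d) ∘ e ≡⟨ assoc ⟩ e ∘ (d ∘ e) ≡⟨ cong (e ∘_) d∘e≡id ⟩ e ∘ id ≡⟨ identityʳ ⟩ e ∎)
      (begin m ∘ (e ∘ d) ≡⟨ sym assoc ⟩ (m ∘ e) ∘ d ≡⟨ cong (_∘ d) (sym f≡me) ⟩ f ∘ d ≡⟨ f∘d≡m ⟩ m ∎)
      identityˡ identityʳ

module PointedCoalgebras {o ℓ p} {𝒞 : Category o ℓ} (FS : FactorizationSystem 𝒞 p)
  (F : Endofunctor 𝒞) (I : Category.Obj 𝒞) where
  open Category 𝒞
  open FactorizationSystem FS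
  open Endofunctor F
  open PointedCoalgebra
  open FactorizationProperties FS
  open ≡-Reasoning

  -- a ∘ s and F s ∘ r are both fill-ins of  r ∘ e = F h ∘ (a ∘ s′).
  fill-in-preserves-str : PreservesM 𝒞 M F → (X A R : PointedCoalgebra 𝒞 F I)
    {e : Hom (carrier X) (carrier R)} {h : Hom (carrier A) (carrier R)}
    {s′ : Hom (carrier X) (carrier A)} {s : Hom (carrier R) (carrier A)} →
    str R ∘ e ≡ F₁ e ∘ str X → E e → str R ∘ h ≡ F₁ h ∘ str A → M h →
    str A ∘ s′ ≡ F₁ s′ ∘ str X → h ∘ s′ ≡ e → s ∘ e ≡ s′ → h ∘ s ≡ id →
    str A ∘ s ≡ F₁ s ∘ str R
  fill-in-preserves-str preserve X A R {e} {h} {s′} {s} e-str Ee h-str Mh s′-str h∘s′≡e s∘e≡s′ h∘s≡id =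
    diagonal-unique Ee (preserve Mh) square
      (begin
        (str A ∘ s) ∘ e       ≡⟨ assoc ⟩
        str A ∘ (s ∘ e)       ≡⟨ cong (str A ∘_) s∘e≡s′ ⟩
        str A ∘ s′            ∎)
      (begin
        F₁ h ∘ (str A ∘ s)    ≡⟨ sym assoc ⟩
        (F₁ h ∘ str A) ∘ s    ≡⟨ cong (_∘ s) (sym h-str) ⟩
        (str R ∘ h) ∘ s       ≡⟨ assoc ⟩
        str R ∘ (h ∘ s)       ≡⟨ cong (str R ∘_) h∘s≡id ⟩
        str R ∘ id            ≡⟨ identityʳ ⟩
        str R                 ∎)
      (begin
        (F₁ s ∘ str R) ∘ e    ≡⟨ assoc ⟩
        F₁ s ∘ (str R ∘ e)    ≡⟨ cong (F₁ s ∘_) e-str ⟩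
        F₁ s ∘ (F₁ e ∘ str X) ≡⟨ sym assoc ⟩
        (F₁ s ∘ F₁ e) ∘ str X ≡⟨ cong (_∘ str X) (sym homomorphism) ⟩
        F₁ (s ∘ e) ∘ str X    ≡⟨ cong (λ x → F₁ x ∘ str X) s∘e≡s′ ⟩
        F₁ s′ ∘ str X         ≡⟨ sym s′-str ⟩
        str A ∘ s′            ∎)
      (begin
        F₁ h ∘ (F₁ s ∘ str R) ≡⟨ sym assoc ⟩
        (F₁ h ∘ F₁ s) ∘ str R ≡⟨ cong (_∘ str R) (sym homomorphism) ⟩
        F₁ (h ∘ s) ∘ str R    ≡⟨ cong (λ x → F₁ x ∘ str R) h∘s≡id ⟩
        F₁ id ∘ str R         ≡⟨ cong (_∘ str R) identity ⟩
        id ∘ str R            ≡⟨ identityˡ ⟩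
        str R                 ∎)
    where
    square : str R ∘ e ≡ F₁ h ∘ (str A ∘ s′)
    square = begin
      str R ∘ e               ≡⟨ cong (str R ∘_) (sym h∘s′≡e) ⟩
      str R ∘ (h ∘ s′)        ≡⟨ sym assoc ⟩
      (str R ∘ h) ∘ s′        ≡⟨ cong (_∘ s′) h-str ⟩
      (F₁ h ∘ str A) ∘ s′     ≡⟨ assoc ⟩
      F₁ h ∘ (str A ∘ s′)     ∎

  E-lift⇒split-epi : PreservesM 𝒞 M F → (X A R : PointedCoalgebra 𝒞 F I)
    {e : Hom (carrier X) (carrier R)} {h : Hom (carrier A) (carrier R)}
    {s′ : Hom (carrier X) (carrier A)} →
    IsPointedCoalgebraMorphism 𝒞 F I X R e → E e →
    IsPointedCoalgebraMorphism 𝒞 F I A R h → M h →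
    IsPointedCoalgebraMorphism 𝒞 F I X A s′ → h ∘ s′ ≡ e →
    IsSplitEpiPC 𝒞 F I A R h
  E-lift⇒split-epi preserve X A R {e} {s′ = s′}
    (e-str , e-point) Ee h-mor@(h-str , _) Mh (s′-str , s′-point) h∘s′≡e
    with diagonal Ee Mh (trans identityˡ (sym h∘s′≡e))
  ... | s , s∘e≡s′ , h∘s≡id , _ =
    h-mor , s , (s-str , s-point) , h∘s≡id
    where
    s-str : str A ∘ s ≡ F₁ s ∘ str R
    s-str = fill-in-preserves-str preserve X A R e-str Ee h-str Mh s′-str h∘s′≡e s∘e≡s′ h∘s≡id

    s-point : s ∘ point R ≡ point A
    s-point = begin
      s ∘ point R             ≡⟨ cong (s ∘_) (sym e-point) ⟩
      s ∘ (e ∘ point X)       ≡⟨ sym assoc ⟩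
      (s ∘ e) ∘ point X       ≡⟨ cong (_∘ point X) s∘e≡s′ ⟩
      s′ ∘ point X            ≡⟨ s′-point ⟩
      point A                 ∎

  module Chain (Cₖ : ℕ → Obj) (cₖ : ∀ k → Hom (Cₖ k) (F₀ (Cₖ (suc k)))) (iC′ : Hom I (Cₖ 0)) where

    record ChainMorphism (A : PointedCoalgebra 𝒞 F I) : Set ℓ where
      field
        map           : ∀ k → Hom (Cₖ k) (carrier A)
        str-commute   : ∀ k → str A ∘ map k ≡ F₁ (map (suc k)) ∘ cₖ k
        point-commute : map 0 ∘ iC′ ≡ point A

    module Lifting (precise : ∀ k → IsPrecise 𝒞 M F (cₖ k)) (EiC′ : E iC′)
      {A R : PointedCoalgebra 𝒞 F I} (g : ChainMorphism R)
      (Mg : ∀ k → M (ChainMorphism.map g (suc k)))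
      {h : Hom (carrier A) (carrier R)} (h-mor : IsPointedCoalgebraMorphism 𝒞 F I A R h) (Mh : M h)
      where
      open ChainMorphism g renaming (map to gₖ; str-commute to g-str; point-commute to g-point)

      lift₀ : Σ[ d ∈ Hom (Cₖ 0) (carrier A) ] (d ∘ iC′ ≡ point A) × (h ∘ d ≡ gₖ 0)
      lift₀ with diagonal EiC′ Mh (trans g-point (sym (proj₂ h-mor)))
      ... | d , d∘iC′≡iA , h∘d≡g₀ , _ = d , d∘iC′≡iA , h∘d≡g₀

      liftStep : ∀ k (d : Hom (Cₖ k) (carrier A)) → h ∘ d ≡ gₖ k →
                 Σ[ d′ ∈ Hom (Cₖ (suc k)) (carrier A) ] (F₁ d′ ∘ cₖ k ≡ str A ∘ d) × (h ∘ d′ ≡ gₖ (suc k))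
      liftStep k d h∘d≡gₖ = precise k (str A ∘ d) (gₖ (suc k)) h (Mg k) Mh (begin
        F₁ (gₖ (suc k)) ∘ cₖ k ≡⟨ sym (g-str k) ⟩
        str R ∘ gₖ k           ≡⟨ cong (str R ∘_) (sym h∘d≡gₖ) ⟩
        str R ∘ (h ∘ d)        ≡⟨ sym assoc ⟩
        (str R ∘ h) ∘ d        ≡⟨ cong (_∘ d) (proj₁ h-mor) ⟩
        (F₁ h ∘ str A) ∘ d     ≡⟨ assoc ⟩
        F₁ h ∘ (str A ∘ d)     ∎)

      lifts : ∀ k → Σ[ d ∈ Hom (Cₖ k) (carrier A) ] h ∘ d ≡ gₖ k
      lifts zero    = proj₁ lift₀ , proj₂ (proj₂ lift₀)
      lifts (suc k) with liftStep k (proj₁ (lifts k)) (proj₂ (lifts k))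
      ... | d′ , _ , h∘d′≡g = d′ , h∘d′≡g

      lift : ChainMorphism A
      lift = record
        { map           = λ k → proj₁ (lifts k)
        ; str-commute   = λ k → sym (proj₁ (proj₂ (liftStep k (proj₁ (lifts k)) (proj₂ (lifts k)))))
        ; point-commute = proj₁ (proj₂ lift₀)
        }

      h∘lift : ∀ k → h ∘ ChainMorphism.map lift k ≡ gₖ k
      h∘lift k = proj₂ (lifts k)

    module Colimit (cop : Coproductℕ 𝒞 Cₖ) where
      open Coproductℕ cop

      inj-jointly-epic : ∀ {Y} {f g : Hom ∐ Y} → (∀ k → f ∘ inj k ≡ g ∘ inj k) → f ≡ g
      inj-jointly-epic {g = g} f∘inj≡g∘inj =
        trans (unique (λ k → g ∘ inj k) _ f∘inj≡g∘inj) (sym (unique (λ k → g ∘ inj k) g (λ _ → refl)))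

      ∐-coalgebra : PointedCoalgebra 𝒞 F I
      ∐-coalgebra = pcoalg ∐ [ (λ k → F₁ (inj (suc k)) ∘ cₖ k) ] (inj 0 ∘ iC′)

      ∘inj : ∀ {A} {f : Hom ∐ (carrier A)} → IsPointedCoalgebraMorphism 𝒞 F I ∐-coalgebra A f →
             ChainMorphism A
      ∘inj {A} {f} (f-str , f-point) = record
        { map           = λ k → f ∘ inj k
        ; str-commute   = λ k → begin
            str A ∘ (f ∘ inj k)                     ≡⟨ sym assoc ⟩
            (str A ∘ f) ∘ inj k                     ≡⟨ cong (_∘ inj k) f-str ⟩
            (F₁ f ∘ str ∐-coalgebra) ∘ inj k        ≡⟨ assoc ⟩
            F₁ f ∘ (str ∐-coalgebra ∘ inj k)        ≡⟨ cong (F₁ f ∘_) (commute _ k) ⟩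
            F₁ f ∘ (F₁ (inj (suc k)) ∘ cₖ k)        ≡⟨ sym assoc ⟩
            (F₁ f ∘ F₁ (inj (suc k))) ∘ cₖ k        ≡⟨ cong (_∘ cₖ k) (sym homomorphism) ⟩
            F₁ (f ∘ inj (suc k)) ∘ cₖ k             ∎
        ; point-commute = trans assoc f-point
        }

      copair : ∀ {A} (d : ChainMorphism A) →
               IsPointedCoalgebraMorphism 𝒞 F I ∐-coalgebra A [ ChainMorphism.map d ]
      copair {A} d = inj-jointly-epic str-on-inj , point-commute′
        where
        open ChainMorphism d
        str-on-inj : ∀ k → (str A ∘ [ map ]) ∘ inj k ≡ (F₁ [ map ] ∘ str ∐-coalgebra) ∘ inj k
        str-on-inj k = begin
          (str A ∘ [ map ]) ∘ inj k               ≡⟨ assoc ⟩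
          str A ∘ ([ map ] ∘ inj k)               ≡⟨ cong (str A ∘_) (commute map k) ⟩
          str A ∘ map k                           ≡⟨ str-commute k ⟩
          F₁ (map (suc k)) ∘ cₖ k                 ≡⟨ cong (λ x → F₁ x ∘ cₖ k) (sym (commute map (suc k))) ⟩
          F₁ ([ map ] ∘ inj (suc k)) ∘ cₖ k       ≡⟨ cong (_∘ cₖ k) homomorphism ⟩
          (F₁ [ map ] ∘ F₁ (inj (suc k))) ∘ cₖ k  ≡⟨ assoc ⟩
          F₁ [ map ] ∘ (F₁ (inj (suc k)) ∘ cₖ k)  ≡⟨ cong (F₁ [ map ] ∘_) (sym (commute _ k)) ⟩
          F₁ [ map ] ∘ (str ∐-coalgebra ∘ inj k)  ≡⟨ sym assoc ⟩
          (F₁ [ map ] ∘ str ∐-coalgebra) ∘ inj k  ∎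
        point-commute′ : [ map ] ∘ (inj 0 ∘ iC′) ≡ point A
        point-commute′ = trans (sym assoc) (trans (cong (_∘ iC′) (commute map 0)) point-commute)

      E-quotient-isMReachable : PreservesM 𝒞 M F → (∀ k → IsPrecise 𝒞 M F (cₖ k)) → E iC′ →
        (R : PointedCoalgebra 𝒞 F I) {e : Hom ∐ (carrier R)} →
        IsPointedCoalgebraMorphism 𝒞 F I ∐-coalgebra R e → E e → (∀ k → M (e ∘ inj (suc k))) →
        IsMReachable 𝒞 F I M R
      E-quotient-isMReachable preserve precise EiC′ R {e} e-mor Ee Me∘inj A h h-mor Mh =
        E-lift⇒split-epi preserve ∐-coalgebra A R e-mor Ee h-mor Mh (copair lift)
          (inj-jointly-epic h∘[lift]∘inj)
        where
        open Lifting precise EiC′ (∘inj e-mor) Me∘inj h-mor Mh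
        h∘[lift]∘inj : ∀ k → (h ∘ [ ChainMorphism.map lift ]) ∘ inj k ≡ e ∘ inj k
        h∘[lift]∘inj k = trans assoc (trans (cong (h ∘_) (commute _ k)) (h∘lift k))

theorem4p12 :
    ∀ {o ℓ p} (𝒞 : Category o ℓ) (FS : FactorizationSystem 𝒞 p) (I : Category.Obj 𝒞)
      (F : Endofunctor 𝒞) →
    let open Category 𝒞
        open FactorizationSystem FS
        open Endofunctor F
    in PreservesM 𝒞 M F →
       AdmitsPreciseFactorizations 𝒞 M F →
       -- the pointed coalgebra (C, c, i_C)
       (C : Obj) (c : Hom C (F₀ C)) (iC : Hom I C) →
       -- the chosen data C_k, m_k, c_k, i_C'
       (Cₖ : ℕ → Obj) (m : ∀ k → Hom (Cₖ k) C) (cₖ : ∀ k → Hom (Cₖ k) (F₀ (Cₖ (suc k))))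
       (iC' : Hom I (Cₖ 0)) →
       E iC' → M (m 0) → iC ≡ m 0 ∘ iC' →
       (∀ k → M (m (suc k))) →
       (∀ k → IsPrecise 𝒞 M F (cₖ k)) →
       (∀ k → c ∘ m k ≡ F₁ (m (suc k)) ∘ cₖ k) →
       -- the coproduct of the C_k and its pointed coalgebra structure
       (cop : Coproductℕ 𝒞 Cₖ) →
       let open Coproductℕ cop
           γ : Hom ∐ (F₀ ∐)
           γ = [ (λ k → F₁ (inj (suc k)) ∘ cₖ k) ]
       in
       -- (E,M)-factorization [m_k]_k = m' ∘ e
       (R : Obj) (e : Hom ∐ R) (m' : Hom R C) →
       E e → M m' → [ m ] ≡ m' ∘ e →
       -- r : the (unique) diagonal fill-in
       (r : Hom R (F₀ R)) → r ∘ e ≡ F₁ e ∘ γ → F₁ m' ∘ r ≡ c ∘ m' →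
       let iR : Hom I R
           iR = e ∘ (inj 0 ∘ iC')
       in IsMReachable 𝒞 F I M (pcoalg R r iR)
          × (IsPointedCoalgebraMorphism 𝒞 F I (pcoalg R r iR) (pcoalg C c iC) m' × M m')
-- Precise factorizations, M m₀ and c ∘ m_k = F m_{k+1} ∘ c_k are only needed to construct
-- the data; reachability of R does not use them.
theorem4p12 𝒞 FS I F preserve _ C c iC Cₖ m cₖ iC′ EiC′ _ iC≡m₀∘iC′ Mm precise _ cop
            R e m′ Ee Mm′ [m]≡m′∘e r r∘e≡Fe∘γ Fm′∘r≡c∘m′ =
  E-quotient-isMReachable preserve precise EiC′ (pcoalg R r (e ∘ (inj 0 ∘ iC′)))
    (r∘e≡Fe∘γ , refl) Ee Me∘inj
  , (sym Fm′∘r≡c∘m′ , m′-point) , Mm′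
  where
  open Category 𝒞
  open FactorizationSystem FS
  open FactorizationProperties FS
  open PointedCoalgebras FS F I
  open Chain Cₖ cₖ iC′
  open Colimit cop
  open Coproductℕ cop
  open ≡-Reasoning

  m′∘e∘inj : ∀ k → m′ ∘ (e ∘ inj k) ≡ m k
  m′∘e∘inj k = trans (sym assoc) (trans (cong (_∘ inj k) (sym [m]≡m′∘e)) (commute m k))

  Me∘inj : ∀ k → M (e ∘ inj (suc k))
  Me∘inj k = M-cancelˡ Mm′ (subst (λ x → M x) (sym (m′∘e∘inj (suc k))) (Mm k))

  m′-point : m′ ∘ (e ∘ (inj 0 ∘ iC′)) ≡ iC
  m′-point = begin
    m′ ∘ (e ∘ (inj 0 ∘ iC′)) ≡⟨ cong (m′ ∘_) (sym assoc) ⟩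
    m′ ∘ ((e ∘ inj 0) ∘ iC′) ≡⟨ sym assoc ⟩
    (m′ ∘ (e ∘ inj 0)) ∘ iC′ ≡⟨ cong (_∘ iC′) (m′∘e∘inj 0) ⟩
    m 0 ∘ iC′               ≡⟨ sym iC≡m₀∘iC′ ⟩
    iC                       ∎
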